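{- There exists a $2$-coloring of the grid $\{0,1,\dots,179\}^3$ such that no axis-parallel cube $\{x,x+s\}\times\{y,y+s\}\times\{z,z+s\}$ (with $s$ a positive integer) contained in the grid is monochromatic. Consequently $\Gamma(\{0,1\}^3,2)\ge 181$.
   Context: $\Gamma(\{0,1\}^3,2)$ is the least $m$ such that every $2$-coloring of $\{0,\dots,m-1\}^3$ makes some axis-parallel cube $\{x,x+s\}\times\{y,y+s\}\times\{z,z+s\}$, $s\ge1$, contained in the grid monochromatic. -}

module Defs where

open import Data.Nat using (ℕ; suc; _+_; _<_; _≤_)
open import Data.Bool using (Bool)
open import Data.Product using (Σ; _×_; ∃)
open import Relation.Binary.PropositionalEquality using (_≡_)
open import Relation.Nullary using (¬_)

-- A 2-coloring of the grid {0,…,m-1}^3, given on ℕ³; only the values at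
-- points with all coordinates < m matter for the notions below.
Coloring : Set
Coloring = ℕ → ℕ → ℕ → Bool

MonoCube : ℕ → Coloring → Set
MonoCube m c =
  Σ ℕ λ x → Σ ℕ λ y → Σ ℕ λ z → Σ ℕ λ s →
    (1 ≤ s) × (x + s < m) × (y + s < m) × (z + s < m) ×
    Σ Bool λ b →
      (c x y z ≡ b) × (c (x + s) y z ≡ b) × (c x (y + s) z ≡ b) × (c x y (z + s) ≡ b) ×
      (c (x + s) (y + s) z ≡ b) × (c (x + s) y (z + s) ≡ b) ×
      (c x (y + s) (z + s) ≡ b) × (c (x + s) (y + s) (z + s) ≡ b)

CubeRamsey : ℕ → Set
CubeRamsey m = (c : Coloring) → MonoCube m c

-- Γ({0,1}^3,2) ≥ n : no m < n has the property (Γ is the least m with it).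
GammaAtLeast : ℕ → Set
GammaAtLeast n = (m : ℕ) → m < n → ¬ CubeRamsey m

{-# OPTIONS --safe #-}
module Submission where

-- The linear form x + 2y + 3z sends the vertices of the cube with corner (x, y, z) and side s
-- onto t, t + s, …, t + 6s for t = x + 2y + 3z (both (x+s, y+s, z) and (x, y, z+s) land on
-- t + 3s). Colouring (x, y, z) by w (x + 2y + 3z) therefore leaves no monochromatic cube in
-- {0,…,179}³ as soon as w has no monochromatic 7-term progression in {0,…,1074}. We take
-- w i = [i is a quadratic residue mod 181] and check that property by evaluation. A colouring
-- without monochromatic cubes on a grid has none on smaller grids, which gives Γ ≥ 181.

open import Defs
open import Data.Bool using (Bool; true; false; not; _∧_; _∨_; T)
open import Data.Bool.ListAction using (all; any)
open import Data.Bool.Properties using (T-∧; T-∨; T-≡; T-not-≡)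
open import Data.List
  using (List; []; _∷_; map; drop; applyUpTo; applyDownFrom; downFrom; length)
open import Data.List.Properties using (map-∘; map-cong)
open import Data.List.Membership.Propositional.Properties using (∈-applyDownFrom⁺)
open import Data.List.Relation.Unary.All as All using (All)
open import Data.List.Relation.Unary.All.Properties
  using (all⁺; all⁻; map⁺; applyUpTo⁺₁)
open import Data.Nat
  using (ℕ; zero; suc; _+_; _*_; _∸_; _≤_; _<_; _≡ᵇ_; s≤s; s≤s⁻¹; NonZero)
open import Data.Nat.DivMod using (_%_)
open import Data.Nat.Properties
  using (≤-trans; ≤-<-trans; <-≤-trans; <⇒≤; m≤n+m; m≤n*m; m+n∸n≡m; +-comm; +-identityʳ;
         +-mono-≤; +-monoʳ-≤; *-monoʳ-≤; *-monoˡ-≤; ∸-monoˡ-<; module ≤-Reasoning)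
open import Data.Nat.Tactic.RingSolver using (solve-∀)
open import Data.Product using (Σ; _×_; _,_; proj₁; proj₂)
open import Data.Sum using (inj₁; inj₂)
open import Function using (_∘_; Equivalence)
open import Relation.Binary.PropositionalEquality
  using (_≡_; refl; sym; trans; cong; subst; module ≡-Reasoning)
open import Relation.Nullary using (¬_)

_!_ : List Bool → ℕ → Bool
[]       ! _     = false
(b ∷ _)  ! zero  = b
(_ ∷ bs) ! suc i = bs ! i

drop-! : ∀ k bs i → drop k bs ! i ≡ bs ! (k + i)
drop-! zero    bs       i = refl
drop-! (suc k) []       i = refl
drop-! (suc k) (_ ∷ bs) i = drop-! k bs i

applyUpTo-! : ∀ (f : ℕ → Bool) n {i} → i < n → applyUpTo f n ! i ≡ f i
applyUpTo-! f (suc n) {zero}  _         = refl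
applyUpTo-! f (suc n) {suc i} (s≤s i<n) = applyUpTo-! (f ∘ suc) n i<n

-- d counts steps: the progression t, t + s, …, t + d * s has d + 1 terms.
MonoAP : ℕ → ℕ → (ℕ → Bool) → Set
MonoAP d n f =
  Σ ℕ λ t → Σ ℕ λ s → (1 ≤ s) × (t + d * s < n) ×
    Σ Bool λ b → ∀ {k} → k ≤ d → f (t + k * s) ≡ b

MonoAP-cong : ∀ {d n f g} → (∀ {i} → i < n → f i ≡ g i) →
              MonoAP d n f → MonoAP d n g
MonoAP-cong f≡g (t , s , 1≤s , last<n , b , mono) =
  t , s , 1≤s , last<n , b , λ {k} k≤d →
    trans (sym (f≡g (≤-<-trans (+-monoʳ-≤ t (*-monoˡ-≤ s k≤d)) last<n))) (mono k≤d)

monochromatic? : List Bool → Bool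
monochromatic? bs = all (λ b → b) bs ∨ all not bs

monochromatic?-complete : ∀ {b bs} → All (_≡ b) bs → T (monochromatic? bs)
monochromatic?-complete {true}  same =
  Equivalence.from T-∨ (inj₁ (all⁻ _ (All.map (Equivalence.from T-≡) same)))
monochromatic?-complete {false} same =
  Equivalence.from T-∨ (inj₂ (all⁻ _ (All.map (Equivalence.from T-not-≡) same)))

T-not⇒¬T : ∀ {b} → T (not b) → ¬ T b
T-not⇒¬T {false} _ ()

column : ℕ → List (List Bool) → List Bool
column i rows = map (_! i) rows

column-drop : ∀ i rows → column i (map (drop 1) rows) ≡ column (suc i) rows
column-drop i rows = trans (sym (map-∘ rows)) (map-cong (λ row → drop-! 1 row i) rows)

columnsMixed? : ℕ → List (List Bool) → Bool
columnsMixed? zero    rows = true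
columnsMixed? (suc n) rows =
  not (monochromatic? (column 0 rows)) ∧ columnsMixed? n (map (drop 1) rows)

columnsMixed?-sound : ∀ n rows → T (columnsMixed? n rows) →
                      ∀ {i} → i < n → ¬ T (monochromatic? (column i rows))
columnsMixed?-sound (suc n) rows mixed {zero}  _         =
  T-not⇒¬T (proj₁ (Equivalence.to T-∧ mixed))
columnsMixed?-sound (suc n) rows mixed {suc i} (s≤s i<n) =
  subst (λ c → ¬ T (monochromatic? c)) (column-drop i rows)
    (columnsMixed?-sound n (map (drop 1) rows) (proj₂ (Equivalence.to T-∧ mixed)) i<n)

-- Row k is w shifted by k * s, so column t lists the colours of t, t + s, …, t + d * s.
progressionRows : ℕ → ℕ → List Bool → List (List Bool)
progressionRows d s w = applyUpTo (λ k → drop (k * s) w) (suc d)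

noMonoAPWithStep? : ℕ → List Bool → ℕ → Bool
noMonoAPWithStep? d w s = columnsMixed? (length w ∸ d * s) (progressionRows d s w)

noMonoAP? : ℕ → List Bool → Bool
noMonoAP? d w = all (noMonoAPWithStep? d w) (applyDownFrom suc (length w))

noMonoAP?-sound : ∀ d .{{_ : NonZero d}} w →
                  noMonoAP? d w ≡ true → ¬ MonoAP d (length w) (w !_)
noMonoAP?-sound d w checked (_ , zero , () , _)
noMonoAP?-sound d w checked (t , s@(suc s′) , _ , last<n , b , mono) =
  columnsMixed?-sound (n ∸ d * s) (progressionRows d s w) stepChecked t<n∸ds columnMono
  where
  n = length w

  s′<n : s′ < n
  s′<n = <⇒≤ (≤-<-trans (≤-trans (m≤n*m s d) (m≤n+m (d * s) t)) last<n)

  stepChecked : T (noMonoAPWithStep? d w s)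
  stepChecked = All.lookup (all⁺ _ _ (Equivalence.from T-≡ checked)) (∈-applyDownFrom⁺ suc s′<n)

  t<n∸ds : t < n ∸ d * s
  t<n∸ds = subst (_< n ∸ d * s) (m+n∸n≡m t (d * s)) (∸-monoˡ-< last<n (m≤n+m (d * s) t))

  shifted-coloured : ∀ {k} → k ≤ d → drop (k * s) w ! t ≡ b
  shifted-coloured {k} k≤d = begin
    drop (k * s) w ! t ≡⟨ drop-! (k * s) w t ⟩
    w ! (k * s + t)    ≡⟨ cong (w !_) (+-comm (k * s) t) ⟩
    w ! (t + k * s)    ≡⟨ mono k≤d ⟩
    b                  ∎
    where open ≡-Reasoning

  columnMono : T (monochromatic? (column t (progressionRows d s w)))
  columnMono = monochromatic?-complete
    (map⁺ {f = _! t} (applyUpTo⁺₁ (λ k → drop (k * s) w) (suc d) (shifted-coloured ∘ s≤s⁻¹)))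

coloring-x+2y+3z : (ℕ → Bool) → Coloring
coloring-x+2y+3z f x y z = f (x + 2 * y + 3 * z)

vertex-x : ∀ x y z s → x + s + 2 * y + 3 * z ≡ x + 2 * y + 3 * z + 1 * s
vertex-x = solve-∀

vertex-y : ∀ x y z s → x + 2 * (y + s) + 3 * z ≡ x + 2 * y + 3 * z + 2 * s
vertex-y = solve-∀

vertex-z : ∀ x y z s → x + 2 * y + 3 * (z + s) ≡ x + 2 * y + 3 * z + 3 * s
vertex-z = solve-∀

vertex-xz : ∀ x y z s → x + s + 2 * y + 3 * (z + s) ≡ x + 2 * y + 3 * z + 4 * s
vertex-xz = solve-∀

vertex-yz : ∀ x y z s → x + 2 * (y + s) + 3 * (z + s) ≡ x + 2 * y + 3 * z + 5 * s
vertex-yz = solve-∀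

vertex-xyz : ∀ x y z s → x + s + 2 * (y + s) + 3 * (z + s) ≡ x + 2 * y + 3 * z + 6 * s
vertex-xyz = solve-∀

n+2n+3n≡6n : ∀ n → n + 2 * n + 3 * n ≡ 6 * n
n+2n+3n≡6n = solve-∀

monoCube⇒monoAP : ∀ n f → MonoCube (suc n) (coloring-x+2y+3z f) → MonoAP 6 (suc (6 * n)) f
monoCube⇒monoAP n f (x , y , z , s , 1≤s , s≤s x+s≤n , s≤s y+s≤n , s≤s z+s≤n , b ,
                     c₀ , cx , cy , cz , _ , cxz , cyz , cxyz) =
  t , s , 1≤s , s≤s last≤6n , b , coloured
  where
  t = x + 2 * y + 3 * z

  last≤6n : t + 6 * s ≤ 6 * n
  last≤6n = begin
    t + 6 * s                         ≡⟨ vertex-xyz x y z s ⟨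
    x + s + 2 * (y + s) + 3 * (z + s) ≤⟨ +-mono-≤ (+-mono-≤ x+s≤n (*-monoʳ-≤ 2 y+s≤n))
                                                   (*-monoʳ-≤ 3 z+s≤n) ⟩
    n + 2 * n + 3 * n                 ≡⟨ n+2n+3n≡6n n ⟩
    6 * n                             ∎
    where open ≤-Reasoning

  coloured : ∀ {k} → k ≤ 6 → f (t + k * s) ≡ b
  coloured {0} _ = subst (λ i → f i ≡ b) (sym (+-identityʳ t)) c₀
  coloured {1} _ = subst (λ i → f i ≡ b) (vertex-x x y z s) cx
  coloured {2} _ = subst (λ i → f i ≡ b) (vertex-y x y z s) cy
  coloured {3} _ = subst (λ i → f i ≡ b) (vertex-z x y z s) cz
  coloured {4} _ = subst (λ i → f i ≡ b) (vertex-xz x y z s) cxz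
  coloured {5} _ = subst (λ i → f i ≡ b) (vertex-yz x y z s) cyz
  coloured {6} _ = subst (λ i → f i ≡ b) (vertex-xyz x y z s) cxyz
  coloured {suc (suc (suc (suc (suc (suc (suc _))))))}
           (s≤s (s≤s (s≤s (s≤s (s≤s (s≤s ()))))))

MonoCube-mono : ∀ {m n c} → m ≤ n → MonoCube m c → MonoCube n c
MonoCube-mono m≤n (x , y , z , s , 1≤s , x+s<m , y+s<m , z+s<m , mono) =
  x , y , z , s , 1≤s ,
  <-≤-trans x+s<m m≤n , <-≤-trans y+s<m m≤n , <-≤-trans z+s<m m≤n , mono

gammaAtLeast-suc : ∀ {n} c → ¬ MonoCube n c → GammaAtLeast (suc n)
gammaAtLeast-suc c ¬cube m (s≤s m≤n) ramsey = ¬cube (MonoCube-mono m≤n (ramsey c))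

quadraticResidue? : (p : ℕ) .{{_ : NonZero p}} → ℕ → Bool
quadraticResidue? p i = not (i % p ≡ᵇ 0) ∧ any (λ j → j * j % p ≡ᵇ i % p) (downFrom p)

residues181 : List Bool
residues181 = applyUpTo (quadraticResidue? 181) 1075

-- Stated with ≡ true rather than T: refl is checked by conversion, which evaluates the
-- check several times faster than checking tt against T would.
residues181-noMonoAP? : noMonoAP? 6 residues181 ≡ true
residues181-noMonoAP? = refl

quadraticResidue181-noMonoAP : ¬ MonoAP 6 1075 (quadraticResidue? 181)
quadraticResidue181-noMonoAP =
  noMonoAP?-sound 6 residues181 residues181-noMonoAP?
    ∘ MonoAP-cong (λ i<1075 → sym (applyUpTo-! (quadraticResidue? 181) 1075 i<1075))

mainTheorem11 : Σ Coloring (λ c → ¬ MonoCube 180 c) × GammaAtLeast 181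
mainTheorem11 = (coloring , noCube) , gammaAtLeast-suc coloring noCube
  where
  coloring : Coloring
  coloring = coloring-x+2y+3z (quadraticResidue? 181)

  noCube : ¬ MonoCube 180 coloring
  noCube = quadraticResidue181-noMonoAP ∘ monoCube⇒monoAP 179 (quadraticResidue? 181)
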